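{- Let $\mathsf{JL}$ be a justification logic and $\mathcal{CS}$ a constant specification for $\mathsf{JL}$. If a formula is provable in the tableau system $\mathsf{JL}^{\mathcal T}_{\mathcal{CS}}+(cut)$, then it is also provable in $\mathsf{JL}^{\mathcal T}_{\mathcal{CS}}$.
   Context: Language. Justification terms are built from justification variables and constants using binary $\cdot,+$ and unary $!,\bar?,?$; subterms as usual. Formulas: $A ::= p \mid \bot \mid \neg A \mid A\to A \mid t:A$, $p$ from a countable set $\mathcal P$ of propositional variables. Logics. $\mathsf J$ has axiom schemes: all propositional tautologies; $s:A\to(s+t):A$, $s:A\to(t+s):A$; $s:(A\to B)\to(t:A\to(s\cdot t):B)$. Further schemes: jT: $t:A\to A$; jD: $t:\bot\to\bot$; j4: $t:A\to\,!t:t:A$; jB: $\neg A\to\bar{?}t:\neg t:A$; j5: $\neg t:A\to ?t:\neg t:A$. A justification logic $\mathsf{JL}$ is $\mathsf J$ plus any combination of these; its language contains $\cdot,+$ and those of $!,\bar?,?$ occurring in its axioms. A constant specification $\mathcal{CS}$ for $\mathsf{JL}$ is a downward closed set of formulas $c_{i_n}:\dots:c_{i_1}:A$ ($n\ge1$, constants $c_{i_j}$, $A$ an axiom instance of $\mathsf{JL}$): if $c_{i_n}:c_{i_{n-1}}:\dots:c_{i_1}:A\in\mathcal{CS}$, $n\ge2$, then $c_{i_{n-1}}:\dots:c_{i_1}:A\in\mathcal{CS}$. Subformulas. "$A$ is a $\mathsf{JL}_{\mathcal{CS}}$-subformula of $B$" is the least relation such that: $A=B$; or $B=\neg F$ and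 $A$ is one of $F$; or $B=F\to G$ and $A$ is one of $F$ or of $G$; or $B=t:F$ and $A$ is one of $F$; or $A=t:F$ where $t$ is a subterm of a term occurring in $B$ and $F$ is one of $B$; or $A$ is one of some $c_{i_n}:\dots:c_{i_1}:F\in\mathcal{CS}$; closed under transitivity. $\mathsf{JL}^{\mathcal T}_{\mathcal{CS}}$-tableaux. A tableau for $F$ has root $\neg F$, extended by rule applications whose premises lie on the extended branch. Rules: $(F\neg)$: $\neg\neg A$ / $A$; $(F\to)$: $\neg(A\to B)$ / $A,\neg B$; $(T\to)$: $A\to B$ / $\neg A$ | $B$; $(F+_L)$: $\neg(t+s):A$ / $\neg t:A$; $(F+_R)$: $\neg(t+s):A$ / $\neg s:A$; $(T\cdot)$: from $s:(A\to B)$ and $t:A$ on the branch add $(s\cdot t):B$, provided all three are $\mathsf{JL}_{\mathcal{CS}}$-subformulas of the root; $(PB)$: split into $A$ | $\neg A$, provided $A$ is a $\mathsf{JL}_{\mathcal{CS}}$-subformula of the root. Additionally: with jT, $(T:)$: $t:A$ / $A$; with jD, $(T:_\bot)$: $t:\bot$ / $\bot$; with j4, $(F!)$: $\neg!t:t:A$ / $\neg t:A$; with jB, $(F\bar?)$: $\neg\bar?t:\neg t:A$ / $A$; with j5, $(F?)$: $\neg?t:\neg t:A$ / $t:A$. A branch closes if it contains $A$ and $\neg A$, or $\bot$, or $\neg c:F$ with $c:F\in\mathcal{CS}$; a tableau is closed if all branches close. A formula $F$ is provable in a tableau system if there is a closed tableau of that system with root $\neg F$. The system $\mathsf{JL}^{\mathcal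 T}_{\mathcal{CS}}+(cut)$ additionally has the rule $(cut)$: split any branch into $A$ | $\neg A$ for an arbitrary formula $A$. -}

module Defs where

open import Data.Nat using (ℕ)
open import Data.Bool using (Bool; true; false; T; not; _∧_; _∨_)
open import Data.List using (List; _∷_; [])
open import Data.List.Membership.Propositional using (_∈_)
open import Relation.Binary.PropositionalEquality using (_≡_)

-- Logics: J plus any combination of jT, jD, j4, jB, j5

record Logic : Set where
  field
    hasT hasD has4 hasB has5 : Bool
open Logic public

data Tm (L : Logic) : Set where
  jvar   : ℕ → Tm L
  jconst : ℕ → Tm L
  _·_    : Tm L → Tm L → Tm L
  _⊕_    : Tm L → Tm L → Tm L
  bang   : T (has4 L) → Tm L → Tm L
  qbar   : T (hasB L) → Tm L → Tm L
  qm     : T (has5 L) → Tm L → Tm L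

infixl 7 _·_
infixl 6 _⊕_

data Fm (L : Logic) : Set where
  atom : ℕ → Fm L
  fls  : Fm L
  neg  : Fm L → Fm L
  _⇒_  : Fm L → Fm L → Fm L
  _∶_  : Tm L → Fm L → Fm L

infixr 4 _⇒_
infixr 5 _∶_

eval : {L : Logic} → (Fm L → Bool) → Fm L → Bool
eval v (atom p) = v (atom p)
eval v fls      = false
eval v (neg A)  = not (eval v A)
eval v (A ⇒ B)  = not (eval v A) ∨ eval v B
eval v (t ∶ A)  = v (t ∶ A)

Tautology : {L : Logic} → Fm L → Set
Tautology A = ∀ v → eval v A ≡ true

data Axiom (L : Logic) : Fm L → Set where
  taut : ∀ {A} → Tautology A → Axiom L A
  sumL : ∀ s t A → Axiom L ((s ∶ A) ⇒ ((s ⊕ t) ∶ A))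
  sumR : ∀ s t A → Axiom L ((s ∶ A) ⇒ ((t ⊕ s) ∶ A))
  appl : ∀ s t A B → Axiom L ((s ∶ (A ⇒ B)) ⇒ ((t ∶ A) ⇒ ((s · t) ∶ B)))
  axT  : T (hasT L) → ∀ t A → Axiom L ((t ∶ A) ⇒ A)
  axD  : T (hasD L) → ∀ t → Axiom L ((t ∶ fls) ⇒ fls)
  ax4  : (p : T (has4 L)) → ∀ t A → Axiom L ((t ∶ A) ⇒ (bang p t ∶ t ∶ A))
  axB  : (p : T (hasB L)) → ∀ t A → Axiom L (neg A ⇒ (qbar p t ∶ neg (t ∶ A)))
  ax5  : (p : T (has5 L)) → ∀ t A → Axiom L (neg (t ∶ A) ⇒ (qm p t ∶ neg (t ∶ A)))

data CSShape (L : Logic) : Fm L → Set where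
  base : ∀ c {A} → Axiom L A → CSShape L (jconst c ∶ A)
  step : ∀ c {G} → CSShape L G → CSShape L (jconst c ∶ G)

record ConstSpec (L : Logic) : Set₁ where
  field
    CS        : Fm L → Set
    shape     : ∀ {F} → CS F → CSShape L F
    downward  : ∀ c G → CS (jconst c ∶ G) → CSShape L G → CS G
open ConstSpec public

data Subterm {L : Logic} : Tm L → Tm L → Set where
  here  : ∀ {t} → Subterm t t
  appL  : ∀ {t s u} → Subterm t s → Subterm t (s · u)
  appR  : ∀ {t s u} → Subterm t u → Subterm t (s · u)
  sumSL : ∀ {t s u} → Subterm t s → Subterm t (s ⊕ u)
  sumSR : ∀ {t s u} → Subterm t u → Subterm t (s ⊕ u)
  bangS : ∀ {t s p} → Subterm t s → Subterm t (bang p s)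
  qbarS : ∀ {t s p} → Subterm t s → Subterm t (qbar p s)
  qmS   : ∀ {t s p} → Subterm t s → Subterm t (qm p s)

data TermIn {L : Logic} : Tm L → Fm L → Set where
  just : ∀ {s F} → TermIn s (s ∶ F)
  inBx : ∀ {s t F} → TermIn s F → TermIn s (t ∶ F)
  inNg : ∀ {s F} → TermIn s F → TermIn s (neg F)
  inIL : ∀ {s F G} → TermIn s F → TermIn s (F ⇒ G)
  inIR : ∀ {s F G} → TermIn s G → TermIn s (F ⇒ G)

-- JL_CS-subformulas:  Sub CS A B  means "A is a JL_CS-subformula of B"

data Sub {L : Logic} (cs : ConstSpec L) : Fm L → Fm L → Set where
  refl   : ∀ {B} → Sub cs B B
  negS   : ∀ {A F} → Sub cs A F → Sub cs A (neg F)
  impSL  : ∀ {A F G} → Sub cs A F → Sub cs A (F ⇒ G)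
  impSR  : ∀ {A F G} → Sub cs A G → Sub cs A (F ⇒ G)
  boxS   : ∀ {A t F} → Sub cs A F → Sub cs A (t ∶ F)
  termS  : ∀ {t s F B} → Subterm t s → TermIn s B → Sub cs F B → Sub cs (t ∶ F) B
  csS    : ∀ {A G B} → CS cs G → Sub cs A G → Sub cs A B
  trans  : ∀ {A C B} → Sub cs A C → Sub cs C B → Sub cs A B

-- Closes L cs cut root Γ : every branch of some tableau extending the
-- current branch Γ (list of formulas on the branch, root included) closes.

data Closes (L : Logic) (cs : ConstSpec L) (cut : Bool) (root : Fm L)
  : List (Fm L) → Set where
  clContr : ∀ {Γ A} → A ∈ Γ → neg A ∈ Γ → Closes L cs cut root Γ
  clBot   : ∀ {Γ} → fls ∈ Γ → Closes L cs cut root Γ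
  clCS    : ∀ {Γ c F} → neg (jconst c ∶ F) ∈ Γ → CS cs (jconst c ∶ F)
          → Closes L cs cut root Γ
  rF¬  : ∀ {Γ A} → neg (neg A) ∈ Γ → Closes L cs cut root (A ∷ Γ)
       → Closes L cs cut root Γ
  rF→  : ∀ {Γ A B} → neg (A ⇒ B) ∈ Γ → Closes L cs cut root (neg B ∷ A ∷ Γ)
       → Closes L cs cut root Γ
  rT→  : ∀ {Γ A B} → (A ⇒ B) ∈ Γ → Closes L cs cut root (neg A ∷ Γ)
       → Closes L cs cut root (B ∷ Γ) → Closes L cs cut root Γ
  rF+L : ∀ {Γ t s A} → neg ((t ⊕ s) ∶ A) ∈ Γ → Closes L cs cut root (neg (t ∶ A) ∷ Γ)
       → Closes L cs cut root Γ
  rF+R : ∀ {Γ t s A} → neg ((t ⊕ s) ∶ A) ∈ Γ → Closes L cs cut root (neg (s ∶ A) ∷ Γ)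
       → Closes L cs cut root Γ
  rT·  : ∀ {Γ s t A B} → (s ∶ (A ⇒ B)) ∈ Γ → (t ∶ A) ∈ Γ
       → Sub cs (s ∶ (A ⇒ B)) root → Sub cs (t ∶ A) root → Sub cs ((s · t) ∶ B) root
       → Closes L cs cut root (((s · t) ∶ B) ∷ Γ) → Closes L cs cut root Γ
  rPB  : ∀ {Γ} A → Sub cs A root → Closes L cs cut root (A ∷ Γ)
       → Closes L cs cut root (neg A ∷ Γ) → Closes L cs cut root Γ
  rT:  : ∀ {Γ t A} → T (hasT L) → (t ∶ A) ∈ Γ → Closes L cs cut root (A ∷ Γ)
       → Closes L cs cut root Γ
  rT:⊥ : ∀ {Γ t} → T (hasD L) → (t ∶ fls) ∈ Γ → Closes L cs cut root (fls ∷ Γ)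
       → Closes L cs cut root Γ
  rF!  : ∀ {Γ t A} (p : T (has4 L)) → neg (bang p t ∶ t ∶ A) ∈ Γ
       → Closes L cs cut root (neg (t ∶ A) ∷ Γ) → Closes L cs cut root Γ
  rF?̄  : ∀ {Γ t A} (p : T (hasB L)) → neg (qbar p t ∶ neg (t ∶ A)) ∈ Γ
       → Closes L cs cut root (A ∷ Γ) → Closes L cs cut root Γ
  rF?  : ∀ {Γ t A} (p : T (has5 L)) → neg (qm p t ∶ neg (t ∶ A)) ∈ Γ
       → Closes L cs cut root ((t ∶ A) ∷ Γ) → Closes L cs cut root Γ
  rCut : ∀ {Γ} → T cut → (A : Fm L) → Closes L cs cut root (A ∷ Γ)
       → Closes L cs cut root (neg A ∷ Γ) → Closes L cs cut root Γ

ProvableT : (L : Logic) → ConstSpec L → Fm L → Set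
ProvableT L cs F = Closes L cs false (neg F) (neg F ∷ [])

ProvableTcut : (L : Logic) → ConstSpec L → Fm L → Set
ProvableTcut L cs F = Closes L cs true (neg F) (neg F ∷ [])

-- Cut is admissible, by induction on the cut formula A with an inner induction
-- on the closed tableau for A ∷ Γ. A cut on ¬A is a cut on A once ¬¬A has been
-- inverted. For an unnegated A, the occurrences of A are erased from the tableau
-- for A ∷ Γ while the tableau for ¬A ∷ Γ is carried along: a contradiction on A
-- is closed by that tableau, a (T·) step using A becomes an analytic (PB) on A
-- (A is then a subformula of the root), and an expansion of A itself becomes cuts
-- on its immediate subformulas, whose negative premisses come from the inversion
-- lemmas for ¬(B → C), ¬t:F (with jT) and ¬t:⊥ (with jD). Weakening, these
-- inversions and the erasure of A are all instances of one lemma tracing a set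
-- of formulas through a closed tableau.
module Submission where

open import Defs
open import Data.Bool using (true; false; T)
open import Data.Empty using (⊥; ⊥-elim)
open import Data.Unit using (⊤; tt)
open import Data.Sum using (_⊎_; inj₁; inj₂)
import Data.Sum as Sum
open import Data.Product using (∃; _×_; _,_)
open import Data.List using (List; _∷_; []; [_]; _++_)
open import Data.List.Membership.Propositional using (_∈_)
open import Data.List.Relation.Unary.Any using (here; there)
open import Data.List.Relation.Unary.All as All using (All; _∷_; []; lookup; tabulate)
open import Data.List.Relation.Unary.All.Properties using (++⁺)
open import Data.List.Relation.Binary.Subset.Propositional using (_⊆_)
open import Data.List.Relation.Binary.Subset.Propositional.Properties
  using (∷⁺ʳ; ∈-∷⁺ʳ; ⊆-refl; xs⊆xs++ys; xs⊆ys++xs)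
open import Function using (_∘_; id)
open import Relation.Binary.PropositionalEquality using (_≡_; refl)

module _ (L : Logic) (cs : ConstSpec L) (root : Fm L) where

  Closed : List (Fm L) → Set
  Closed = Closes L cs false root

  -- The single-premise rules: the premise, and the formulas each branch adds.
  data Rule : Fm L → List (List (Fm L)) → Set where
    F¬  : ∀ {A} → Rule (neg (neg A)) [ [ A ] ]
    F⇒  : ∀ {A B} → Rule (neg (A ⇒ B)) [ neg B ∷ [ A ] ]
    T⇒  : ∀ {A B} → Rule (A ⇒ B) ([ neg A ] ∷ [ [ B ] ])
    F⊕ˡ : ∀ {t s A} → Rule (neg ((t ⊕ s) ∶ A)) [ [ neg (t ∶ A) ] ]
    F⊕ʳ : ∀ {t s A} → Rule (neg ((t ⊕ s) ∶ A)) [ [ neg (s ∶ A) ] ]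
    T∶  : ∀ {t A} → T (hasT L) → Rule (t ∶ A) [ [ A ] ]
    T∶⊥ : ∀ {t} → T (hasD L) → Rule (t ∶ fls) [ [ fls ] ]
    F!  : ∀ {t A} (p : T (has4 L)) → Rule (neg (bang p t ∶ t ∶ A)) [ [ neg (t ∶ A) ] ]
    F?̄  : ∀ {t A} (p : T (hasB L)) → Rule (neg (qbar p t ∶ neg (t ∶ A))) [ [ A ] ]
    F?  : ∀ {t A} (p : T (has5 L)) → Rule (neg (qm p t ∶ neg (t ∶ A))) [ [ t ∶ A ] ]

  expand : ∀ {Γ X bs} → X ∈ Γ → Rule X bs → All (λ b → Closed (b ++ Γ)) bs → Closed Γ
  expand m F¬      (d ∷ [])     = rF¬ m d
  expand m F⇒      (d ∷ [])     = rF→ m d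
  expand m T⇒      (d ∷ e ∷ []) = rT→ m d e
  expand m F⊕ˡ     (d ∷ [])     = rF+L m d
  expand m F⊕ʳ     (d ∷ [])     = rF+R m d
  expand m (T∶ p)  (d ∷ [])     = rT: p m d
  expand m (T∶⊥ p) (d ∷ [])     = rT:⊥ p m d
  expand m (F! p)  (d ∷ [])     = rF! p m d
  expand m (F?̄ p)  (d ∷ [])     = rF?̄ p m d
  expand m (F? p)  (d ∷ [])     = rF? p m d

  -- A handler closes Δ at
  -- every step of the tableau for Γ that uses an erased formula; Resume Δ b is
  -- the rest of the tableau below such a step, on a branch extended by b.
  module Erasure (Erased : Fm L → Set) (Inv : List (Fm L) → Set) where

    _⊆ₑ_ : List (Fm L) → List (Fm L) → Set
    Γ ⊆ₑ Δ = All (λ X → Erased X ⊎ X ∈ Δ) Γ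

    Erasable : List (Fm L) → Set
    Erasable Γ = ∀ {Δ} → Inv Δ → Γ ⊆ₑ Δ → Closed Δ

    Resume : List (Fm L) → List (Fm L) → Set
    Resume Δ b = ∀ {Δ′} → Inv Δ′ → Δ ⊆ Δ′ → b ⊆ₑ Δ′ → Closed Δ′

    record Handler : Set where
      field
        inv-mono      : ∀ {Δ Δ′} → Inv Δ → Δ ⊆ Δ′ → Inv Δ′
        consistent    : ∀ {X} → Erased X → Erased (neg X) → ⊥
        clash         : ∀ {Δ X} → Inv Δ → Erased X → neg X ∈ Δ → Closed Δ
        clash-neg     : ∀ {Δ X} → Inv Δ → Erased (neg X) → X ∈ Δ → Closed Δ
        clash-⊥       : ∀ {Δ} → Inv Δ → Erased fls → Closed Δ
        clash-CS      : ∀ {Δ c F} → Inv Δ → Erased (neg (jconst c ∶ F))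
                      → CS cs (jconst c ∶ F) → Closed Δ
        expand-erased : ∀ {Δ X bs} → Inv Δ → Erased X → Rule X bs
                      → All (Resume Δ) bs → Closed Δ
        apply-erased  : ∀ {Δ s t A B} → Inv Δ → Erased (s ∶ (A ⇒ B)) ⊎ Erased (t ∶ A)
                      → ((s ∶ (A ⇒ B)) ∷ [ t ∶ A ]) ⊆ₑ Δ
                      → Sub cs (s ∶ (A ⇒ B)) root → Sub cs (t ∶ A) root
                      → Sub cs ((s · t) ∶ B) root
                      → Resume Δ [ (s · t) ∶ B ] → Closed Δ

    module _ (H : Handler) where
      open Handler H

      resume : ∀ {Γ Δ b} → Erasable (b ++ Γ) → Γ ⊆ₑ Δ → Resume Δ b
      resume k c q s c′ = k q (++⁺ c′ (All.map (Sum.map₂ s) c))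

      resume-all : ∀ {Γ Δ bs} → All (λ b → Erasable (b ++ Γ)) bs → Γ ⊆ₑ Δ
                 → All (Resume Δ) bs
      resume-all []       _ = []
      resume-all (k ∷ ks) c = resume k c ∷ resume-all ks c

      continue : ∀ {Δ b} → Inv Δ → Resume Δ b → Closed (b ++ Δ)
      continue {Δ} {b} q r =
        r (inv-mono q (xs⊆ys++xs Δ b)) (xs⊆ys++xs Δ b) (tabulate (inj₂ ∘ xs⊆xs++ys b Δ))

      by-rule : ∀ {Γ X bs} → X ∈ Γ → Rule X bs → All (λ b → Erasable (b ++ Γ)) bs
              → Erasable Γ
      by-rule m ρ ks q c with lookup c m
      ... | inj₁ e = expand-erased q e ρ (resume-all ks c)
      ... | inj₂ x = expand x ρ (All.map (continue q) (resume-all ks c))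

      erase : ∀ {Γ} → Closed Γ → Erasable Γ
      erase (clContr m n) q c with lookup c m | lookup c n
      ... | inj₂ x | inj₂ y = clContr x y
      ... | inj₁ e | inj₂ y = clash q e y
      ... | inj₂ x | inj₁ e = clash-neg q e x
      ... | inj₁ e | inj₁ e′ = ⊥-elim (consistent e e′)
      erase (clBot m) q c with lookup c m
      ... | inj₁ e = clash-⊥ q e
      ... | inj₂ x = clBot x
      erase (clCS m k) q c with lookup c m
      ... | inj₁ e = clash-CS q e k
      ... | inj₂ x = clCS x k
      erase (rF¬ m d)      = by-rule m F¬ (erase d ∷ [])
      erase (rF→ m d)      = by-rule m F⇒ (erase d ∷ [])
      erase (rT→ m d e)    = by-rule m T⇒ (erase d ∷ erase e ∷ [])
      erase (rF+L m d)     = by-rule m F⊕ˡ (erase d ∷ [])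
      erase (rF+R m d)     = by-rule m F⊕ʳ (erase d ∷ [])
      erase (rT: p m d)    = by-rule m (T∶ p) (erase d ∷ [])
      erase (rT:⊥ p m d)   = by-rule m (T∶⊥ p) (erase d ∷ [])
      erase (rF! p m d)    = by-rule m (F! p) (erase d ∷ [])
      erase (rF?̄ p m d)    = by-rule m (F?̄ p) (erase d ∷ [])
      erase (rF? p m d)    = by-rule m (F? p) (erase d ∷ [])
      erase (rT· m n s₁ s₂ s₃ d) q c with lookup c m | lookup c n
      ... | inj₂ x | inj₂ y = rT· x y s₁ s₂ s₃ (continue q (resume (erase d) c))
      ... | inj₁ e | y      =
        apply-erased q (inj₁ e) (inj₁ e ∷ y ∷ []) s₁ s₂ s₃ (resume (erase d) c)
      ... | inj₂ x | inj₁ e =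
        apply-erased q (inj₂ e) (inj₂ x ∷ inj₁ e ∷ []) s₁ s₂ s₃ (resume (erase d) c)
      erase (rPB A s d e) q c =
        rPB A s (continue q (resume (erase d) c)) (continue q (resume (erase e) c))
      erase (rCut () _ _ _)

  open Erasure using (Handler; erase)
  open Handler

  weaken : ∀ {Γ Δ} → Γ ⊆ Δ → Closed Γ → Closed Δ
  weaken s d = erase _ _ nothing d tt (tabulate (inj₂ ∘ s))
    where
      nothing : Handler (λ _ → ⊥) (λ _ → ⊤)
      inv-mono      nothing _ _ = tt
      consistent    nothing ()
      clash         nothing _ ()
      clash-neg     nothing _ ()
      clash-⊥       nothing _ ()
      clash-CS      nothing _ ()
      expand-erased nothing _ ()
      apply-erased  nothing _ (inj₁ ())
      apply-erased  nothing _ (inj₂ ())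

  ¬¬-inversion : ∀ {Y Γ} → Closed (neg (neg Y) ∷ Γ) → Closed (Y ∷ Γ)
  ¬¬-inversion {Y} d = erase _ _ handler d (here refl) (inj₁ refl ∷ tabulate (inj₂ ∘ there))
    where
      handler : Handler (_≡ neg (neg Y)) (Y ∈_)
      inv-mono      handler y s = s y
      consistent    handler refl ()
      clash         handler y refl n = rF¬ n (clContr (there y) (here refl))
      clash-neg     handler y refl x = clContr y x
      clash-⊥       handler _ ()
      clash-CS      handler _ ()
      expand-erased handler y refl F¬ (r ∷ []) = r y id (inj₂ y ∷ [])
      apply-erased  handler _ (inj₁ ())
      apply-erased  handler _ (inj₂ ())

  drop-¬⊥ : ∀ {Γ} → Closed (neg fls ∷ Γ) → Closed Γ
  drop-¬⊥ d = erase _ _ handler d tt (inj₁ refl ∷ tabulate inj₂)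
    where
      handler : Handler (_≡ neg fls) (λ _ → ⊤)
      inv-mono      handler _ _ = tt
      consistent    handler refl ()
      clash         handler _ refl n = rF¬ n (clBot (here refl))
      clash-neg     handler _ refl x = clBot x
      clash-⊥       handler _ ()
      clash-CS      handler _ ()
      expand-erased handler _ refl ()
      apply-erased  handler _ (inj₁ ())
      apply-erased  handler _ (inj₂ ())

  drop-¬⇒ : ∀ {B C Γ} → Closed (neg (B ⇒ C) ∷ Γ) → B ∈ Γ → neg C ∈ Γ → Closed Γ
  drop-¬⇒ {B} {C} d b c = erase _ _ handler d (b , c) (inj₁ refl ∷ tabulate inj₂)
    where
      handler : Handler (_≡ neg (B ⇒ C)) (λ Δ → B ∈ Δ × neg C ∈ Δ)
      inv-mono      handler (b , c) s = s b , s c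
      consistent    handler refl ()
      clash         handler (b , c) refl n =
        rF¬ n (rT→ (here refl) (clContr (there (there b)) (here refl))
                               (clContr (here refl) (there (there c))))
      clash-neg     handler (b , c) refl x =
        rT→ x (clContr (there b) (here refl)) (clContr (here refl) (there c))
      clash-⊥       handler _ ()
      clash-CS      handler _ ()
      expand-erased handler (b , c) refl F⇒ (r ∷ []) = r (b , c) id (inj₂ c ∷ inj₂ b ∷ [])
      apply-erased  handler _ (inj₁ ())
      apply-erased  handler _ (inj₂ ())

  -- The erased formulas are all ¬s:F, since the (F+) rules turn one into others.
  drop-¬∶ : ∀ {t F Γ} → T (hasT L) → Closed (neg (t ∶ F) ∷ Γ) → neg F ∈ Γ → Closed Γ
  drop-¬∶ {t} {F} jT d f = erase _ _ handler d f (inj₁ (t , refl) ∷ tabulate inj₂)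
    where
      handler : Handler (λ X → ∃ λ s → X ≡ neg (s ∶ F)) (neg F ∈_)
      inv-mono      handler f s = s f
      consistent    handler (_ , refl) (_ , ())
      clash         handler f (_ , refl) n =
        rF¬ n (rT: jT (here refl) (clContr (here refl) (there (there f))))
      clash-neg     handler f (_ , refl) x = rT: jT x (clContr (here refl) (there f))
      clash-⊥       handler _ (_ , ())
      clash-CS      handler f (_ , refl) k =
        rPB _ (csS k refl) (rT: jT (here refl) (clContr (here refl) (there (there f))))
                           (clCS (here refl) k)
      expand-erased handler f (_ , refl) F⊕ˡ (r ∷ []) = r f id (inj₁ (_ , refl) ∷ [])
      expand-erased handler f (_ , refl) F⊕ʳ (r ∷ []) = r f id (inj₁ (_ , refl) ∷ [])
      expand-erased handler f (_ , refl) (F! _) (r ∷ []) = r f id (inj₂ f ∷ [])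
      expand-erased handler f (_ , refl) (F?̄ _) (r ∷ []) =
        rF¬ f (rT: jT (here refl)
                   (r (there (there f)) (there ∘ there) (inj₂ (here refl) ∷ [])))
      expand-erased handler f (_ , refl) (F? _) (r ∷ []) =
        rF¬ f (r (there f) there (inj₂ (here refl) ∷ []))
      apply-erased  handler _ (inj₁ (_ , ()))
      apply-erased  handler _ (inj₂ (_ , ()))

  drop-¬∶⊥ : ∀ {t Γ} → T (hasD L) → Closed (neg (t ∶ fls) ∷ Γ) → Closed Γ
  drop-¬∶⊥ {t} jD d = erase _ _ handler d tt (inj₁ (t , refl) ∷ tabulate inj₂)
    where
      handler : Handler (λ X → ∃ λ s → X ≡ neg (s ∶ fls)) (λ _ → ⊤)
      inv-mono      handler _ _ = tt
      consistent    handler (_ , refl) (_ , ())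
      clash         handler _ (_ , refl) n = rF¬ n (rT:⊥ jD (here refl) (clBot (here refl)))
      clash-neg     handler _ (_ , refl) x = rT:⊥ jD x (clBot (here refl))
      clash-⊥       handler _ (_ , ())
      clash-CS      handler _ (_ , refl) k =
        rPB _ (csS k refl) (rT:⊥ jD (here refl) (clBot (here refl))) (clCS (here refl) k)
      expand-erased handler q (_ , refl) F⊕ˡ (r ∷ []) = r q id (inj₁ (_ , refl) ∷ [])
      expand-erased handler q (_ , refl) F⊕ʳ (r ∷ []) = r q id (inj₁ (_ , refl) ∷ [])
      apply-erased  handler _ (inj₁ (_ , ()))
      apply-erased  handler _ (inj₂ (_ , ()))

  CutAdmissible : Fm L → Set
  CutAdmissible A = ∀ {Γ} → Closed (A ∷ Γ) → Closed (neg A ∷ Γ) → Closed Γ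

  data _≺_ : Fm L → Fm L → Set where
    antecedent : ∀ {B C} → B ≺ (B ⇒ C)
    consequent : ∀ {B C} → C ≺ (B ⇒ C)
    body       : ∀ {t F} → F ≺ (t ∶ F)

  data Unnegated : Fm L → Set where
    atom : ∀ {p} → Unnegated (atom p)
    fls  : Unnegated fls
    imp  : ∀ {B C} → Unnegated (B ⇒ C)
    box  : ∀ {t F} → Unnegated (t ∶ F)

  cut-unnegated : ∀ {A} → Unnegated A → (∀ {B} → B ≺ A → CutAdmissible B) → CutAdmissible A
  cut-unnegated {A} u ih d e = erase _ _ handler d e (inj₁ (u , refl) ∷ tabulate inj₂)
    where
      Erased : Fm L → Set
      Erased X = Unnegated X × X ≡ A

      grow : ∀ {Δ Δ′} → Δ ⊆ Δ′ → Closed (neg A ∷ Δ) → Closed (neg A ∷ Δ′)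
      grow s = weaken (∷⁺ʳ (neg A) s)

      kept : ∀ {X Δ} → Erased X ⊎ X ∈ Δ → X ∈ A ∷ Δ
      kept (inj₁ (_ , refl)) = here refl
      kept (inj₂ x) = there x

      erased-sub : ∀ {X Y} → Erased X ⊎ Erased Y → Sub cs X root → Sub cs Y root
                 → Sub cs A root
      erased-sub (inj₁ (_ , refl)) s _ = s
      erased-sub (inj₂ (_ , refl)) _ s = s

      handler : Handler Erased (λ Δ → Closed (neg A ∷ Δ))
      inv-mono      handler q s = grow s q
      consistent    handler _ (() , _)
      clash         handler q (_ , refl) n = weaken (∈-∷⁺ʳ n ⊆-refl) q
      clash-neg     handler _ (() , _)
      clash-⊥       handler q (_ , refl) = drop-¬⊥ q
      clash-CS      handler _ (() , _)
      expand-erased handler _ (atom , _) ()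
      expand-erased handler _ (fls , _) ()
      -- A cut on B ⇒ C becomes a cut on B, whose positive premiss is a cut on C.
      expand-erased handler q (imp , refl) T⇒ (r₁ ∷ r₂ ∷ []) =
        ih antecedent
          (ih consequent
             (r₂ (grow (there ∘ there) q) (there ∘ there) (inj₂ (here refl) ∷ []))
             (drop-¬⇒ (grow (there ∘ there) q) (there (here refl)) (here refl)))
          (r₁ (grow there q) there (inj₂ (here refl) ∷ []))
      expand-erased handler q (box , refl) (T∶ jT) (r ∷ []) =
        ih body (r (grow there q) there (inj₂ (here refl) ∷ []))
                (drop-¬∶ jT (grow there q) (here refl))
      expand-erased handler q (box , refl) (T∶⊥ jD) _ = drop-¬∶⊥ jD q
      apply-erased  handler q w (c₁ ∷ c₂ ∷ []) s₁ s₂ s₃ r =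
        rPB A (erased-sub w s₁ s₂)
          (rT· (kept c₁) (kept c₂) s₁ s₂ s₃
               (r (grow (there ∘ there) q) (there ∘ there) (inj₂ (here refl) ∷ [])))
          q

  cut : ∀ A → CutAdmissible A
  cut (neg A) d e = cut A (¬¬-inversion e) d
  cut (atom p)    = cut-unnegated atom (λ ())
  cut fls         = cut-unnegated fls (λ ())
  cut (B ⇒ C)     = cut-unnegated imp λ { antecedent → cut B ; consequent → cut C }
  cut (t ∶ F)     = cut-unnegated box λ { body → cut F }

  eliminate-cuts : ∀ {Γ} → Closes L cs true root Γ → Closed Γ
  eliminate-cuts (clContr a b)         = clContr a b
  eliminate-cuts (clBot a)             = clBot a
  eliminate-cuts (clCS a k)            = clCS a k
  eliminate-cuts (rF¬ a d)             = rF¬ a (eliminate-cuts d)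
  eliminate-cuts (rF→ a d)             = rF→ a (eliminate-cuts d)
  eliminate-cuts (rT→ a d e)           = rT→ a (eliminate-cuts d) (eliminate-cuts e)
  eliminate-cuts (rF+L a d)            = rF+L a (eliminate-cuts d)
  eliminate-cuts (rF+R a d)            = rF+R a (eliminate-cuts d)
  eliminate-cuts (rT· a b s₁ s₂ s₃ d)  = rT· a b s₁ s₂ s₃ (eliminate-cuts d)
  eliminate-cuts (rPB A s d e)         = rPB A s (eliminate-cuts d) (eliminate-cuts e)
  eliminate-cuts (rT: p a d)           = rT: p a (eliminate-cuts d)
  eliminate-cuts (rT:⊥ p a d)          = rT:⊥ p a (eliminate-cuts d)
  eliminate-cuts (rF! p a d)           = rF! p a (eliminate-cuts d)
  eliminate-cuts (rF?̄ p a d)           = rF?̄ p a (eliminate-cuts d)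
  eliminate-cuts (rF? p a d)           = rF? p a (eliminate-cuts d)
  eliminate-cuts (rCut _ A d e)        = cut A (eliminate-cuts d) (eliminate-cuts e)

theorem6 : (L : Logic) (cs : ConstSpec L) (F : Fm L)
    → ProvableTcut L cs F → ProvableT L cs F
theorem6 L cs F = eliminate-cuts L cs (neg F)
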